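{- $\displaystyle\sum_{n\ge1}|\Pi_n(1/24/3)|\,z^n=\frac{z-4z^2+6z^3-2z^4}{(1-3z+2z^2)^2}.$
   Context: The standardization of a set partition of a finite set $S\subset\mathbb{Z}_{>0}$ replaces the $i$-th smallest element of $S$ by $i$. A set partition $\pi$ of $[n]$ contains $\tau\vdash[k]$ if for some $S\subseteq[n]$ the standardization of the restriction of $\pi$ to $S$ is $\tau$; otherwise it avoids $\tau$. $\Pi_n(\tau)$ is the set of partitions of $[n]$ avoiding $\tau$. $1/24/3$ is the partition of $[4]$ with blocks $\{1\},\{2,4\},\{3\}$. -}

module Defs where

open import Data.Nat as ℕ using (ℕ; zero; suc; _≡ᵇ_)
open import Data.Nat.Properties using (≡ᵇ⇒≡; ≡⇒≡ᵇ)
open import Data.Integer as ℤ using (ℤ; +_; -[1+_])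
open import Data.Fin using (Fin; zero; suc; _<_)
open import Data.Bool using (Bool; true; false; T)
open import Data.Vec using (Vec; lookup; tabulate)
open import Data.Vec.Properties using (lookup∘tabulate)
open import Data.List using (List; []; _∷_; map)
open import Data.Product using (∃; _×_)
open import Relation.Nullary using (¬_)
open import Relation.Binary using (IsEquivalence)
open import Relation.Binary.PropositionalEquality
  using (_≡_; refl; sym; trans; subst)

-- Set partitions of [n] (elements encoded as Fin n, i.e. 0..n-1),
-- encoded by their "same block" relation, stored as a Bool matrix
-- (so that equality of partitions is structural, needed for counting).
-- The equivalence-relation proof is irrelevant, so two set partitions
-- are equal iff their relation matrices are equal.

Rel : ∀ {n} → Vec (Vec Bool n) n → Fin n → Fin n → Set
Rel M i j = T (lookup (lookup M i) j)

record SetPartition (n : ℕ) : Set where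
  constructor mkSP
  field
    rel      : Vec (Vec Bool n) n
    .isEquiv : IsEquivalence (Rel rel)
open SetPartition public

SameBlock : ∀ {n} → SetPartition n → Fin n → Fin n → Set
SameBlock π = Rel (rel π)

-- π ⊢ [n] contains τ ⊢ [k]: there is S ⊆ [n] (the image of a strictly
-- increasing f : [k] → [n], f(i) being the i-th smallest element of S)
-- such that the standardization of π restricted to S is τ, i.e.
-- f i, f j are in the same block of π iff i, j are in the same block of τ.
Contains : ∀ {n k} → SetPartition n → SetPartition k → Set
Contains {n} {k} π τ =
  ∃ λ (f : Fin k → Fin n) →
      (∀ i j → i < j → f i < f j)
    × (∀ i j → lookup (lookup (rel π) (f i)) (f j) ≡ lookup (lookup (rel τ) i) j)

record Avoiding (n : ℕ) {k : ℕ} (τ : SetPartition k) : Set where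
  constructor mkAv
  field
    part    : SetPartition n
    .avoids : ¬ Contains part τ

fromLabels : ∀ {n} → (Fin n → ℕ) → SetPartition n
fromLabels {n} ℓ = mkSP M eqv
  where
  M : Vec (Vec Bool n) n
  M = tabulate λ i → tabulate λ j → ℓ i ≡ᵇ ℓ j
  toEq : ∀ i j → Rel M i j → ℓ i ≡ ℓ j
  toEq i j r rewrite lookup∘tabulate (λ i → tabulate λ j → ℓ i ≡ᵇ ℓ j) i
                   | lookup∘tabulate (λ j → ℓ i ≡ᵇ ℓ j) j = ≡ᵇ⇒≡ (ℓ i) (ℓ j) r
  fromEq : ∀ i j → ℓ i ≡ ℓ j → Rel M i j
  fromEq i j e rewrite lookup∘tabulate (λ i → tabulate λ j → ℓ i ≡ᵇ ℓ j) i
                     | lookup∘tabulate (λ j → ℓ i ≡ᵇ ℓ j) j = ≡⇒≡ᵇ (ℓ i) (ℓ j) e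
  eqv : IsEquivalence (Rel M)
  eqv = record
    { refl  = λ {i} → fromEq i i refl
    ; sym   = λ {i} {j} r → fromEq j i (sym (toEq i j r))
    ; trans = λ {i} {j} {k} r s → fromEq i k (trans (toEq i j r) (toEq j k s))
    }

-- 1/24/3 : blocks {1},{2,4},{3} of [4]  (0-indexed: {0},{1,3},{2})
label-1/24/3 : Fin 4 → ℕ
label-1/24/3 zero                   = 0
label-1/24/3 (suc zero)             = 1
label-1/24/3 (suc (suc zero))       = 2
label-1/24/3 (suc (suc (suc zero))) = 1

τ-1/24/3 : SetPartition 4
τ-1/24/3 = fromLabels label-1/24/3

-- Polynomials (coefficient lists, constant term first) over ℤ and
-- formal power series (ℕ → ℤ).

polyAdd : List ℤ → List ℤ → List ℤ
polyAdd []       q        = q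
polyAdd (x ∷ p)  []       = x ∷ p
polyAdd (x ∷ p)  (y ∷ q)  = (x ℤ.+ y) ∷ polyAdd p q

polyMul : List ℤ → List ℤ → List ℤ
polyMul []      q = []
polyMul (x ∷ p) q = polyAdd (map (x ℤ.*_) q) (+ 0 ∷ polyMul p q)

coeff : List ℤ → ℕ → ℤ
coeff []      n       = + 0
coeff (x ∷ p) zero    = x
coeff (x ∷ p) (suc n) = coeff p n

-- coefficient of z^n of (polynomial p) * (power series s)
mulSeries : List ℤ → (ℕ → ℤ) → ℕ → ℤ
mulSeries []      s n       = + 0
mulSeries (d ∷ p) s zero    = d ℤ.* s zero
mulSeries (d ∷ p) s (suc n) = d ℤ.* s (suc n) ℤ.+ mulSeries p (λ m → s m) n

seriesFrom1 : (ℕ → ℕ) → ℕ → ℤ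
seriesFrom1 a zero    = + 0
seriesFrom1 a (suc n) = + a (suc n)

-- 1 - 3z + 2z^2
den₀ : List ℤ
den₀ = + 1 ∷ -[1+ 2 ] ∷ + 2 ∷ []

-- z - 4z^2 + 6z^3 - 2z^4
numer : List ℤ
numer = + 0 ∷ + 1 ∷ -[1+ 3 ] ∷ + 6 ∷ -[1+ 1 ] ∷ []

-- In a partition avoiding 1/24/3 every block other than the block of 0 and the block of the least
-- element f outside it is an interval: if b < c < d with b, d in a common third block and c not, then 0
-- or f, whichever is not in the block of c, completes an occurrence of 1/24/3. Such a partition is
-- therefore determined by a word recording for each element whether it lies in the block of 0 (A), of
-- f (B), continues the interval of its predecessor (C) or opens a new one (N); the remaining avoidance
-- conditions are regular, and the words form the language of a nine-state automaton. Counting its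
-- accepted words state by state gives |Π_{m+1}(1/24/3)| = (m − 2)·2^m + m + 3, a solution of the
-- linear recurrence with characteristic polynomial (1 − 3z + 2z²)² = (1 − z)²(1 − 2z)², which is
-- the asserted rational generating function.

module Submission where

open import Defs
open import Data.Bool using (Bool; true; false; T; not; _∨_; if_then_else_)
open import Data.Bool.ListAction using (all)
open import Data.Bool.Properties using (T?; T-irrelevant; T-≡)
open import Data.Empty using (⊥; ⊥-elim; ⊥-elim-irr)
open import Data.Fin as Fin using (Fin; zero; suc; toℕ; fromℕ<)
open import Data.Fin.Permutation using (↔⇒≡)
open import Data.Fin.Properties using (toℕ<n; toℕ-fromℕ<; fromℕ<-toℕ; +↔⊎; 0↔⊥; 1↔⊤)
open import Data.List using (List; []; _∷_)
open import Data.List.Membership.Propositional using (_∈_)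
import Data.List.Relation.Unary.All as All
open import Data.List.Relation.Unary.All.Properties using (all⁺)
open import Data.List.Relation.Unary.Any using (here; there)
open import Data.Nat using (ℕ; zero; suc; _+_; _*_; _^_; _≤_; _<_; z≤n; s≤s; s≤s⁻¹; _≤?_; _<?_; _≡ᵇ_)
open import Data.Nat.Properties
open import Data.Nat.Tactic.RingSolver using (solve-∀)
open import Data.Product using (Σ; ∃; _×_; _,_; proj₁; proj₂)
open import Data.Sum using (_⊎_; inj₁; inj₂)
open import Data.Sum.Function.Propositional using (_⊎-↔_)
open import Data.Unit using (tt)
open import Data.Vec using (Vec; []; _∷_; lookup; tabulate)
open import Data.Vec.Properties using (lookup∘tabulate; tabulate∘lookup; tabulate-cong)
open import Function.Base using (_∘_; case_of_)
open import Function.Bundles using (_↔_; Equivalence; mk↔ₛ′)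
open import Function.Properties.Inverse using (↔-trans; ↔-sym)
open import Relation.Binary using (IsEquivalence)
open import Relation.Binary.Definitions using (tri<; tri≈; tri>)
open import Relation.Binary.PropositionalEquality
open import Relation.Nullary using (¬_; yes; no)
open import Relation.Nullary.Decidable using (recompute)

-- Words and the automaton

-- The i-th letter of the word of a partition of [n] is A if i lies in the block of 0, B if it lies in
-- the block of the least element outside that block, and otherwise C if i is in the block of i − 1, N if not.
data Letter : Set where
  A B C N : Letter

outer : Letter → Bool
outer C = true
outer N = true
outer _ = false

Outer : Letter → Set
Outer x = T (outer x)

-- Recognises  ε | A⁺ (ε | B⁺ (ε | A (A|B)* (ε | N (C|N)*) | N (C|N)* (ε | A⁺ (ε | N (C|N)*)))).
data State : Set where
  q0 q1 q2 q3 q4 q5 q6 q7 dead : State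

δ : State → Letter → State
δ q0 A = q1
δ q1 A = q1
δ q1 B = q2
δ q2 A = q3
δ q2 B = q2
δ q2 N = q4
δ q3 A = q3
δ q3 B = q3
δ q3 N = q5
δ q4 N = q4
δ q4 C = q4
δ q4 A = q6
δ q5 N = q5
δ q5 C = q5
δ q6 A = q6
δ q6 N = q7
δ q7 N = q7
δ q7 C = q7
δ _ _ = dead

live : State → Bool
live dead = false
live _    = true

run : ∀ {n} → State → Vec Letter n → State
run q []      = q
run q (x ∷ v) = run (δ q x) v

stateAfter : ∀ {n} → State → Vec Letter n → ℕ → State
stateAfter q v       zero    = q
stateAfter q []      (suc i) = q
stateAfter q (x ∷ v) (suc i) = stateAfter (δ q x) v i

-- The letter at a position outside the word is the junk value A.
at : ∀ {n} → Vec Letter n → ℕ → Letter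
at []      _       = A
at (x ∷ v) zero    = x
at (x ∷ v) (suc i) = at v i

stateAfter-suc : ∀ {n} q (v : Vec Letter n) i → i < n → stateAfter q v (suc i) ≡ δ (stateAfter q v i) (at v i)
stateAfter-suc q (x ∷ v) zero    _         = refl
stateAfter-suc q (x ∷ v) (suc i) (s≤s i<n) = stateAfter-suc (δ q x) v i i<n

stateAfter-length : ∀ {n} q (v : Vec Letter n) → stateAfter q v n ≡ run q v
stateAfter-length q []      = refl
stateAfter-length q (x ∷ v) = stateAfter-length (δ q x) v

live-δ⁻ : ∀ q x → T (live (δ q x)) → T (live q)
live-δ⁻ dead x ()
live-δ⁻ q0 _ _ = tt
live-δ⁻ q1 _ _ = tt
live-δ⁻ q2 _ _ = tt
live-δ⁻ q3 _ _ = tt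
live-δ⁻ q4 _ _ = tt
live-δ⁻ q5 _ _ = tt
live-δ⁻ q6 _ _ = tt
live-δ⁻ q7 _ _ = tt

live-run⁻ : ∀ {n} q (v : Vec Letter n) → T (live (run q v)) → T (live q)
live-run⁻ q []      acc = acc
live-run⁻ q (x ∷ v) acc = live-δ⁻ q x (live-run⁻ (δ q x) v acc)

live-stateAfter : ∀ {n} q (v : Vec Letter n) i → T (live (run q v)) → T (live (stateAfter q v i))
live-stateAfter q v       zero    acc = live-run⁻ q v acc
live-stateAfter q []      (suc i) acc = acc
live-stateAfter q (x ∷ v) (suc i) acc = live-stateAfter (δ q x) v i acc

states : List State
states = q0 ∷ q1 ∷ q2 ∷ q3 ∷ q4 ∷ q5 ∷ q6 ∷ q7 ∷ dead ∷ []

∈-states : ∀ q → q ∈ states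
∈-states q0   = here refl
∈-states q1   = there (here refl)
∈-states q2   = there (there (here refl))
∈-states q3   = there (there (there (here refl)))
∈-states q4   = there (there (there (there (here refl))))
∈-states q5   = there (there (there (there (there (here refl)))))
∈-states q6   = there (there (there (there (there (there (here refl))))))
∈-states q7   = there (there (there (there (there (there (there (here refl)))))))
∈-states dead = there (there (there (there (there (there (there (there (here refl))))))))

everyState : (State → Bool) → Bool
everyState p = all p states

everyState-sound : ∀ p → T (everyState p) → ∀ q → T (p q)
everyState-sound p h q = All.lookup (all⁺ p states h) (∈-states q)

⇒-sound : ∀ a b c → T (not a ∨ not b ∨ c) → T a → T b → T c
⇒-sound true true c h _ _ = h

Leads : (State → Bool) → Letter → (State → Bool) → Bool
Leads P x P' = everyState (λ q → not (P q) ∨ not (live (δ q x)) ∨ P' (δ q x))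

leads-sound : ∀ P x P' → T (Leads P x P') → ∀ q → T (P q) → T (live (δ q x)) → T (P' (δ q x))
leads-sound P x P' h q =
  ⇒-sound (P q) (live (δ q x)) (P' (δ q x)) (everyState-sound (λ q → not (P q) ∨ not (live (δ q x)) ∨ P' (δ q x)) h q)

letters : List Letter
letters = A ∷ B ∷ C ∷ N ∷ []

∈-letters : ∀ x → x ∈ letters
∈-letters A = here refl
∈-letters B = there (here refl)
∈-letters C = there (there (here refl))
∈-letters N = there (there (there (here refl)))

Stable : (State → Bool) → Bool
Stable P = all (λ x → Leads P x P) letters

stable-sound : ∀ P → T (Stable P) → ∀ x → T (Leads P x P)
stable-sound P h x = All.lookup (all⁺ (λ x → Leads P x P) letters h) (∈-letters x)

-- afterXY… contains every live state reached from q0 by a word having X, Y, … as a subsequence.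
-- Each forbidden configuration of an accepted word is refuted by chasing such sets into noState;
-- the single-letter transitions between the sets are checked by evaluating Leads and Stable.
anyState noState initial beforeB lastInner afterB afterBA afterBAOuter afterOuter afterOuterA afterOuterAOuter
  : State → Bool
anyState _ = true
noState _ = false
initial q0 = true
initial _  = false
beforeB q0 = true
beforeB q1 = true
beforeB _  = false
lastInner q4 = false
lastInner q5 = false
lastInner q7 = false
lastInner _  = true
afterB q0   = false
afterB q1   = false
afterB dead = false
afterB _    = true
afterBA q3 = true
afterBA q5 = true
afterBA q6 = true
afterBA q7 = true
afterBA _  = false
afterBAOuter q5 = true
afterBAOuter q7 = true
afterBAOuter _  = false
afterOuter q4 = true
afterOuter q5 = true
afterOuter q6 = true
afterOuter q7 = true
afterOuter _  = false
afterOuterA q6 = true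
afterOuterA q7 = true
afterOuterA _  = false
afterOuterAOuter q7 = true
afterOuterAOuter _  = false

record Admissible (w : ℕ → Letter) (n : ℕ) : Set where
  field
    starts-A           : 0 < n → w 0 ≡ A
    outer⇒earlier-B    : ∀ i → i < n → Outer (w i) → ∃ λ j → j < i × w j ≡ B
    C⇒follows-outer    : ∀ i → i < n → w i ≡ C → ∃ λ k → i ≡ suc k × Outer (w k)
    no-outer-B         : ∀ i j → i < j → j < n → Outer (w i) → w j ≡ B → ⊥
    no-B-A-outer-A     : ∀ a b c d → a < b → b < c → c < d → d < n →
                         w a ≡ B → w b ≡ A → Outer (w c) → w d ≡ A → ⊥
    no-outer-A-outer-A : ∀ a b c d → a < b → b < c → c < d → d < n →
                         Outer (w a) → w b ≡ A → Outer (w c) → w d ≡ A → ⊥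

-- Accepted words are exactly the admissible ones

module AcceptedWord {n} (v : Vec Letter n) (acc : T (live (run q0 v))) where

  w : ℕ → Letter
  w = at v

  state : ℕ → State
  state = stateAfter q0 v

  step : ∀ P x P' → T (Leads P x P') → ∀ i → i < n → w i ≡ x → T (P (state i)) → T (P' (state (suc i)))
  step P x P' ok i i<n refl h =
    subst (T ∘ P') (sym (stateAfter-suc q0 v i i<n))
      (leads-sound P (w i) P' ok (state i) h
        (subst (T ∘ live) (stateAfter-suc q0 v i i<n) (live-stateAfter q0 v (suc i) acc)))

  stepOuter : ∀ P P' → T (Leads P C P') → T (Leads P N P') →
              ∀ i → i < n → Outer (w i) → T (P (state i)) → T (P' (state (suc i)))
  stepOuter P P' okC okN i i<n o h with w i in e
  ... | C = step P C P' okC i i<n e h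
  ... | N = step P N P' okN i i<n e h

  stays : ∀ P → T (Stable P) → ∀ i j → i ≤ j → j ≤ n → T (P (state i)) → T (P (state j))
  stays P st i zero    z≤n  _     h = h
  stays P st i (suc j) i≤1+j 1+j≤n h with m≤n⇒m<n∨m≡n i≤1+j
  ... | inj₂ refl       = h
  ... | inj₁ (s≤s i≤j) =
    step P (w j) P (stable-sound P st (w j)) j 1+j≤n refl (stays P st i j i≤j (<⇒≤ 1+j≤n) h)

  enter : ∀ P x P' → T (Leads P x P') → T (Stable P') →
          ∀ {i j} → i < j → j ≤ n → w i ≡ x → T (P (state i)) → T (P' (state j))
  enter P x P' ok st {i} {j} i<j j≤n e h = stays P' st (suc i) j i<j j≤n (step P x P' ok i (<-≤-trans i<j j≤n) e h)

  enterOuter : ∀ P P' → T (Leads P C P') → T (Leads P N P') → T (Stable P') →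
               ∀ {i j} → i < j → j ≤ n → Outer (w i) → T (P (state i)) → T (P' (state j))
  enterOuter P P' okC okN st {i} {j} i<j j≤n o h =
    stays P' st (suc i) j i<j j≤n (stepOuter P P' okC okN i (<-≤-trans i<j j≤n) o h)

  starts-A : 0 < n → w 0 ≡ A
  starts-A 0<n with w 0 in e
  ... | A = refl
  ... | B = ⊥-elim (step initial B noState tt 0 0<n e tt)
  ... | C = ⊥-elim (step initial C noState tt 0 0<n e tt)
  ... | N = ⊥-elim (step initial N noState tt 0 0<n e tt)

  beforeB-or-earlier-B : ∀ i → i ≤ n → T (beforeB (state i)) ⊎ ∃ λ j → j < i × w j ≡ B
  beforeB-or-earlier-B zero    _     = inj₁ tt
  beforeB-or-earlier-B (suc i) 1+i≤n with beforeB-or-earlier-B i (<⇒≤ 1+i≤n) | w i in e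
  ... | inj₂ (j , j<i , eB) | _ = inj₂ (j , m<n⇒m<1+n j<i , eB)
  ... | inj₁ h | A = inj₁ (step beforeB A beforeB tt i 1+i≤n e h)
  ... | inj₁ _ | B = inj₂ (i , ≤-refl , e)
  ... | inj₁ h | C = ⊥-elim (step beforeB C noState tt i 1+i≤n e h)
  ... | inj₁ h | N = ⊥-elim (step beforeB N noState tt i 1+i≤n e h)

  outer⇒earlier-B : ∀ i → i < n → Outer (w i) → ∃ λ j → j < i × w j ≡ B
  outer⇒earlier-B i i<n o with beforeB-or-earlier-B i (<⇒≤ i<n)
  ... | inj₁ h     = ⊥-elim (stepOuter beforeB noState tt tt i i<n o h)
  ... | inj₂ found = found

  C⇒follows-outer : ∀ i → i < n → w i ≡ C → ∃ λ k → i ≡ suc k × Outer (w k)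
  C⇒follows-outer zero    0<n   e = ⊥-elim (step lastInner C noState tt 0 0<n e tt)
  C⇒follows-outer (suc k) 1+k<n e with w k in e'
  ... | C = k , refl , subst Outer (sym e') tt
  ... | N = k , refl , subst Outer (sym e') tt
  ... | A = ⊥-elim (step lastInner C noState tt (suc k) 1+k<n e (step anyState A lastInner tt k (<⇒≤ 1+k<n) e' tt))
  ... | B = ⊥-elim (step lastInner C noState tt (suc k) 1+k<n e (step anyState B lastInner tt k (<⇒≤ 1+k<n) e' tt))

  no-outer-B : ∀ i j → i < j → j < n → Outer (w i) → w j ≡ B → ⊥
  no-outer-B i j i<j j<n o e =
    step afterOuter B noState tt j j<n e (enterOuter anyState afterOuter tt tt tt i<j (<⇒≤ j<n) o tt)

  no-B-A-outer-A : ∀ a b c d → a < b → b < c → c < d → d < n →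
                   w a ≡ B → w b ≡ A → Outer (w c) → w d ≡ A → ⊥
  no-B-A-outer-A a b c d a<b b<c c<d d<n ea eb oc ed =
    step afterBAOuter A noState tt d d<n ed
      (enterOuter afterBA afterBAOuter tt tt tt c<d (<⇒≤ d<n) oc
        (enter afterB A afterBA tt tt b<c (<⇒≤ c<n) eb
          (enter anyState B afterB tt tt a<b (<⇒≤ b<n) ea tt)))
    where
    c<n = <-trans c<d d<n
    b<n = <-trans b<c c<n

  no-outer-A-outer-A : ∀ a b c d → a < b → b < c → c < d → d < n →
                       Outer (w a) → w b ≡ A → Outer (w c) → w d ≡ A → ⊥
  no-outer-A-outer-A a b c d a<b b<c c<d d<n oa eb oc ed =
    step afterOuterAOuter A noState tt d d<n ed
      (enterOuter afterOuterA afterOuterAOuter tt tt tt c<d (<⇒≤ d<n) oc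
        (enter afterOuter A afterOuterA tt tt b<c (<⇒≤ c<n) eb
          (enterOuter anyState afterOuter tt tt tt a<b (<⇒≤ b<n) oa tt)))
    where
    c<n = <-trans c<d d<n
    b<n = <-trans b<c c<n

  admissible : Admissible w n
  admissible = record
    { starts-A = starts-A ; outer⇒earlier-B = outer⇒earlier-B ; C⇒follows-outer = C⇒follows-outer
    ; no-outer-B = no-outer-B ; no-B-A-outer-A = no-B-A-outer-A ; no-outer-A-outer-A = no-outer-A-outer-A }

module AdmissibleWord {n} (v : Vec Letter n) (adm : Admissible (at v) n) where
  open Admissible adm

  w : ℕ → Letter
  w = at v

  Inner : Letter → Set
  Inner x = x ≡ A ⊎ x ≡ B

  Reached : State → ℕ → Set
  Reached q0   i = i ≡ 0
  Reached q1   i = ∀ k → k < i → w k ≢ B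
  Reached q2   i = ∃ λ k → i ≡ suc k × w k ≡ B
  Reached q3   i = (∃ λ k → i ≡ suc k × Inner (w k))
                 × (∃ λ p → ∃ λ a → p < a × a < i × w p ≡ B × w a ≡ A)
  Reached q4   i = ∃ λ k → k < i × Outer (w k)
  Reached q5   i = ∃ λ p → ∃ λ a → ∃ λ k → p < a × a < k × k < i × w p ≡ B × w a ≡ A × Outer (w k)
  Reached q6   i = (∃ λ k → i ≡ suc k × w k ≡ A)
                 × (∃ λ k → ∃ λ a → k < a × a < i × Outer (w k) × w a ≡ A)
  Reached q7   i = ∃ λ k → ∃ λ a → ∃ λ k' → k < a × a < k' × k' < i × Outer (w k) × w a ≡ A × Outer (w k')
  Reached dead i = ⊥

  C-outer : ∀ {i} → w i ≡ C → Outer (w i)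
  C-outer e = subst Outer (sym e) tt

  N-outer : ∀ {i} → w i ≡ N → Outer (w i)
  N-outer e = subst Outer (sym e) tt

  C-after-inner : ∀ {i k} → i < n → w i ≡ C → i ≡ suc k → Inner (w k) → ⊥
  C-after-inner {i} i<n e refl inner with C⇒follows-outer i i<n e
  ... | _ , refl , o with inner
  ... | inj₁ eA = subst Outer eA o
  ... | inj₂ eB = subst Outer eB o

  no-outer-before-B : ∀ {i} → i < n → Outer (w i) → (∀ k → k < i → w k ≢ B) → ⊥
  no-outer-before-B {i} i<n o no-B with outer⇒earlier-B i i<n o
  ... | j , j<i , eB = no-B j j<i eB

  advance : ∀ q i → i < n → Reached q i → Reached (δ q (w i)) (suc i)
  advance q0 .0 0<n refl rewrite starts-A 0<n = λ where
    zero    _         eB → case trans (sym (starts-A 0<n)) eB of λ ()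
    (suc k) (s≤s ())
  advance q1 i i<n no-B with w i in e
  ... | A = λ k k<1+i eB → case m≤n⇒m<n∨m≡n (s≤s⁻¹ k<1+i) of λ where
              (inj₁ k<i)  → no-B k k<i eB
              (inj₂ refl) → case trans (sym e) eB of λ ()
  ... | B = i , refl , e
  ... | C = ⊥-elim (no-outer-before-B i<n (C-outer e) no-B)
  ... | N = ⊥-elim (no-outer-before-B i<n (N-outer e) no-B)
  advance q2 i i<n (k , refl , eB) with w i in e
  ... | A = (i , refl , inj₁ e) , (k , i , ≤-refl , ≤-refl , eB , e)
  ... | B = i , refl , e
  ... | C = C-after-inner i<n e refl (inj₂ eB)
  ... | N = i , ≤-refl , N-outer e
  advance q3 i i<n ((k , i≡1+k , inner) , (p , a , p<a , a<i , eB , eA)) with w i in e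
  ... | A = (i , refl , inj₁ e) , (p , a , p<a , m<n⇒m<1+n a<i , eB , eA)
  ... | B = (i , refl , inj₂ e) , (p , a , p<a , m<n⇒m<1+n a<i , eB , eA)
  ... | C = C-after-inner i<n e i≡1+k inner
  ... | N = p , a , i , p<a , a<i , ≤-refl , eB , eA , N-outer e
  advance q4 i i<n (k , k<i , o) with w i in e
  ... | A = (i , refl , e) , (k , i , k<i , ≤-refl , o , e)
  ... | B = no-outer-B k i k<i i<n o e
  ... | C = k , m<n⇒m<1+n k<i , o
  ... | N = k , m<n⇒m<1+n k<i , o
  advance q5 i i<n (p , a , k , p<a , a<k , k<i , eB , eA , o) with w i in e
  ... | A = no-B-A-outer-A p a k i p<a a<k k<i i<n eB eA o e
  ... | B = no-outer-B k i k<i i<n o e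
  ... | C = p , a , k , p<a , a<k , m<n⇒m<1+n k<i , eB , eA , o
  ... | N = p , a , k , p<a , a<k , m<n⇒m<1+n k<i , eB , eA , o
  advance q6 i i<n ((k , i≡1+k , eA) , (k' , a , k'<a , a<i , o , eA')) with w i in e
  ... | A = (i , refl , e) , (k' , a , k'<a , m<n⇒m<1+n a<i , o , eA')
  ... | B = no-outer-B k' i (<-trans k'<a a<i) i<n o e
  ... | C = C-after-inner i<n e i≡1+k (inj₁ eA)
  ... | N = k' , a , i , k'<a , a<i , ≤-refl , o , eA' , N-outer e
  advance q7 i i<n (k , a , k' , k<a , a<k' , k'<i , o , eA , o') with w i in e
  ... | A = no-outer-A-outer-A k a k' i k<a a<k' k'<i i<n o eA o' e
  ... | B = no-outer-B k i (<-trans k<a (<-trans a<k' k'<i)) i<n o e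
  ... | C = k , a , k' , k<a , a<k' , m<n⇒m<1+n k'<i , o , eA , o'
  ... | N = k , a , k' , k<a , a<k' , m<n⇒m<1+n k'<i , o , eA , o'

  reached : ∀ i → i ≤ n → Reached (stateAfter q0 v i) i
  reached zero    _     = refl
  reached (suc i) 1+i≤n rewrite stateAfter-suc q0 v i 1+i≤n =
    advance (stateAfter q0 v i) i 1+i≤n (reached i (<⇒≤ 1+i≤n))

  reached-live : ∀ q {i} → Reached q i → T (live q)
  reached-live q0 _ = tt
  reached-live q1 _ = tt
  reached-live q2 _ = tt
  reached-live q3 _ = tt
  reached-live q4 _ = tt
  reached-live q5 _ = tt
  reached-live q6 _ = tt
  reached-live q7 _ = tt

  accepted : T (live (run q0 v))
  accepted = subst (T ∘ live) (stateAfter-length q0 v) (reached-live _ (reached n ≤-refl))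

-- The partition of a word

classify : ∀ x → x ≡ A ⊎ x ≡ B ⊎ Outer x
classify A = inj₁ refl
classify B = inj₂ (inj₁ refl)
classify C = inj₂ (inj₂ tt)
classify N = inj₂ (inj₂ tt)

A-not-outer : ∀ {x} → x ≡ A → Outer x → ⊥
A-not-outer refl ()

-- The start of the run N C … C ending at i, i.e. the least element of the (interval) block of i.
runStart : (ℕ → Letter) → ℕ → ℕ
runStart w zero = 0
runStart w (suc i) with w (suc i)
... | C = runStart w i
... | _ = suc i

labelOf : Letter → ℕ → ℕ
labelOf A _ = 0
labelOf B _ = 1
labelOf _ r = 2 + r

blockLabel : (ℕ → Letter) → ℕ → ℕ
blockLabel w i = labelOf (w i) (runStart w i)

runStart-≤ : ∀ w i → runStart w i ≤ i
runStart-≤ w zero = z≤n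
runStart-≤ w (suc i) with w (suc i)
... | A = ≤-refl
... | B = ≤-refl
... | C = m≤n⇒m≤1+n (runStart-≤ w i)
... | N = ≤-refl

runStart-N : ∀ w i → w i ≡ N → runStart w i ≡ i
runStart-N w zero    _ = refl
runStart-N w (suc i) e rewrite e = refl

labelOf-A : ∀ {x} r → x ≡ A → labelOf x r ≡ 0
labelOf-A _ refl = refl

labelOf-B : ∀ {x} r → x ≡ B → labelOf x r ≡ 1
labelOf-B _ refl = refl

labelOf-outer : ∀ x r → Outer x → labelOf x r ≡ 2 + r
labelOf-outer C _ _ = refl
labelOf-outer N _ _ = refl

labelOf-zero⁻ : ∀ x r → labelOf x r ≡ 0 → x ≡ A
labelOf-zero⁻ A _ _ = refl

labelOf-injective : ∀ x y r s → labelOf x r ≡ labelOf y s →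
                    (x ≡ A × y ≡ A) ⊎ (x ≡ B × y ≡ B) ⊎ (Outer x × Outer y × r ≡ s)
labelOf-injective A A _ _ _ = inj₁ (refl , refl)
labelOf-injective B B _ _ _ = inj₂ (inj₁ (refl , refl))
labelOf-injective C C _ _ e = inj₂ (inj₂ (tt , tt , suc-injective (suc-injective e)))
labelOf-injective C N _ _ e = inj₂ (inj₂ (tt , tt , suc-injective (suc-injective e)))
labelOf-injective N C _ _ e = inj₂ (inj₂ (tt , tt , suc-injective (suc-injective e)))
labelOf-injective N N _ _ e = inj₂ (inj₂ (tt , tt , suc-injective (suc-injective e)))
labelOf-injective A B _ _ ()
labelOf-injective A C _ _ ()
labelOf-injective A N _ _ ()
labelOf-injective B A _ _ ()
labelOf-injective B C _ _ ()
labelOf-injective B N _ _ ()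
labelOf-injective C A _ _ ()
labelOf-injective C B _ _ ()
labelOf-injective N A _ _ ()
labelOf-injective N B _ _ ()

blockLabel-≤ : ∀ w i → blockLabel w i ≤ 2 + i
blockLabel-≤ w i with w i
... | A = z≤n
... | B = s≤s z≤n
... | C = s≤s (s≤s (runStart-≤ w i))
... | N = s≤s (s≤s (runStart-≤ w i))

module Labels {w : ℕ → Letter} {n : ℕ} (adm : Admissible w n) where
  open Admissible adm

  ℓ : ℕ → ℕ
  ℓ = blockLabel w

  run-interval : ∀ j → j < n → Outer (w j) → ∀ c → runStart w j ≤ c → c ≤ j →
                 Outer (w c) × runStart w c ≡ runStart w j
  run-interval j j<n o c r≤c c≤j with m≤n⇒m<n∨m≡n c≤j
  ... | inj₂ refl = o , refl
  run-interval zero    j<n o c r≤c c≤j | inj₁ ()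
  run-interval (suc j) j<n o c r≤c c≤j | inj₁ c<1+j with w (suc j) in e
  ... | N = ⊥-elim (<⇒≱ c<1+j r≤c)
  ... | C with C⇒follows-outer (suc j) j<n e
  ... | .j , refl , o' = run-interval j (<-trans ≤-refl j<n) o' c r≤c (s≤s⁻¹ c<1+j)

  A-A-pattern : ∀ {a b c d} → a < b → b < c → c < d → d < n → w b ≡ A → w d ≡ A →
                ℓ a ≢ ℓ b → ℓ a ≢ ℓ c → ℓ b ≢ ℓ c → ⊥
  A-A-pattern {a} {b} {c} {d} a<b b<c c<d d<n eb ed ab ac bc with classify (w a) | classify (w c)
  ... | inj₁ ea | _ = ab (trans (labelOf-A _ ea) (sym (labelOf-A _ eb)))
  ... | _ | inj₁ ec = bc (trans (labelOf-A _ eb) (sym (labelOf-A _ ec)))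
  ... | inj₂ (inj₁ ea) | inj₂ (inj₁ ec) = ac (trans (labelOf-B _ ea) (sym (labelOf-B _ ec)))
  ... | inj₂ (inj₁ ea) | inj₂ (inj₂ oc) = no-B-A-outer-A a b c d a<b b<c c<d d<n ea eb oc ed
  ... | inj₂ (inj₂ oa) | inj₂ (inj₁ ec) = no-outer-B a c (<-trans a<b b<c) (<-trans c<d d<n) oa ec
  ... | inj₂ (inj₂ oa) | inj₂ (inj₂ oc) = no-outer-A-outer-A a b c d a<b b<c c<d d<n oa eb oc ed

  B-B-pattern : ∀ {a b c d} → a < b → b < c → c < d → d < n → w b ≡ B → w d ≡ B →
                ℓ a ≢ ℓ b → ℓ a ≢ ℓ c → ℓ b ≢ ℓ c → ⊥
  B-B-pattern {a} {b} {c} {d} a<b b<c c<d d<n eb ed ab ac bc with classify (w c)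
  ... | inj₂ (inj₁ ec) = bc (trans (labelOf-B _ eb) (sym (labelOf-B _ ec)))
  ... | inj₂ (inj₂ oc) = no-outer-B c d c<d d<n oc ed
  ... | inj₁ ec with classify (w a)
  ... | inj₁ ea = ac (trans (labelOf-A _ ea) (sym (labelOf-A _ ec)))
  ... | inj₂ (inj₁ ea) = ab (trans (labelOf-B _ ea) (sym (labelOf-B _ eb)))
  ... | inj₂ (inj₂ oa) = no-outer-B a d (<-trans a<b (<-trans b<c c<d)) d<n oa ed

  outer-pattern : ∀ {b c d} → b < c → c < d → d < n → Outer (w b) → Outer (w d) →
                  runStart w b ≡ runStart w d → ℓ b ≢ ℓ c → ⊥
  outer-pattern {b} {c} {d} b<c c<d d<n ob od rb≡rd bc = bc (begin
    ℓ b                      ≡⟨ labelOf-outer (w b) _ ob ⟩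
    2 + runStart w b         ≡⟨ cong (2 +_) (trans rb≡rd (sym rc≡rd)) ⟩
    2 + runStart w c         ≡⟨ labelOf-outer (w c) _ oc ⟨
    ℓ c                      ∎)
    where
    open ≡-Reasoning
    rd≤c : runStart w d ≤ c
    rd≤c = subst (_≤ c) rb≡rd (≤-trans (runStart-≤ w b) (<⇒≤ b<c))
    oc-rc : Outer (w c) × runStart w c ≡ runStart w d
    oc-rc = run-interval d d<n od c rd≤c (<⇒≤ c<d)
    oc = proj₁ oc-rc
    rc≡rd = proj₂ oc-rc

  labels-avoid : ∀ a b c d → a < b → b < c → c < d → d < n →
                 ℓ b ≡ ℓ d → ℓ a ≢ ℓ b → ℓ a ≢ ℓ c → ℓ b ≢ ℓ c → ⊥
  labels-avoid a b c d a<b b<c c<d d<n bd ab ac bc with labelOf-injective (w b) (w d) _ _ bd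
  ... | inj₁ (eb , ed)               = A-A-pattern a<b b<c c<d d<n eb ed ab ac bc
  ... | inj₂ (inj₁ (eb , ed))        = B-B-pattern a<b b<c c<d d<n eb ed ab ac bc
  ... | inj₂ (inj₂ (ob , od , rbd)) = outer-pattern b<c c<d d<n ob od rbd bc

-- The word of a partition

-- The least k < n with p k, or n if there is none.
firstTrue : (ℕ → Bool) → ℕ → ℕ
firstTrue p zero    = zero
firstTrue p (suc n) = if p 0 then 0 else suc (firstTrue (p ∘ suc) n)

firstTrue-minimal : ∀ p n k → k < firstTrue p n → p k ≡ false
firstTrue-minimal p (suc n) k h with p 0 in e
firstTrue-minimal p (suc n) zero    h       | false = e
firstTrue-minimal p (suc n) (suc k) (s≤s h) | false = firstTrue-minimal (p ∘ suc) n k h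

firstTrue-found : ∀ p n → firstTrue p n < n → p (firstTrue p n) ≡ true
firstTrue-found p (suc n) h with p 0 in e
... | true  = e
... | false = firstTrue-found (p ∘ suc) n (s≤s⁻¹ h)

firstTrue-≤ : ∀ p n i → i < n → p i ≡ true → firstTrue p n ≤ i
firstTrue-≤ p n i i<n pi with firstTrue p n ≤? i
... | yes le = le
... | no  gt = case trans (sym pi) (firstTrue-minimal p n i (≰⇒> gt)) of λ ()

firstTrue-cong : ∀ p p' n → (∀ k → k < n → p k ≡ p' k) → firstTrue p n ≡ firstTrue p' n
firstTrue-cong p p' zero    h = refl
firstTrue-cong p p' (suc n) h rewrite h 0 (s≤s z≤n) with p' 0
... | true  = refl
... | false = cong suc (firstTrue-cong (p ∘ suc) (p' ∘ suc) n (λ k k<n → h (suc k) (s≤s k<n)))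

letterFrom : Bool → Bool → Bool → Letter
letterFrom true  _     _     = A
letterFrom false true  _     = B
letterFrom false false true  = C
letterFrom false false false = N

letterFrom-A : ∀ a b c → letterFrom a b c ≡ A → a ≡ true
letterFrom-A true  _     _     _ = refl
letterFrom-A false true  _     ()
letterFrom-A false false true  ()
letterFrom-A false false false ()

letterFrom-B : ∀ a b c → letterFrom a b c ≡ B → a ≡ false × b ≡ true
letterFrom-B true  _     _     ()
letterFrom-B false true  _     _ = refl , refl
letterFrom-B false false true  ()
letterFrom-B false false false ()

letterFrom-outer : ∀ a b c → Outer (letterFrom a b c) → a ≡ false × b ≡ false
letterFrom-outer true  _     _     ()
letterFrom-outer false true  _     ()
letterFrom-outer false false true  _ = refl , refl
letterFrom-outer false false false _ = refl , refl

letterFrom-C : ∀ a b c → letterFrom a b c ≡ C → c ≡ true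
letterFrom-C true  _     _     ()
letterFrom-C false true  _     ()
letterFrom-C false false true  _ = refl
letterFrom-C false false false ()

letterFrom-N : ∀ a b c → letterFrom a b c ≡ N → c ≡ false
letterFrom-N true  _     _     ()
letterFrom-N false true  _     ()
letterFrom-N false false true  ()
letterFrom-N false false false _ = refl

letterFrom-false-false : ∀ c → Outer (letterFrom false false c)
letterFrom-false-false true  = tt
letterFrom-false-false false = tt

firstOutside : (ℕ → ℕ → Bool) → ℕ → ℕ
firstOutside S n = firstTrue (λ k → not (S 0 k)) n

withPredecessor : (ℕ → ℕ → Bool) → ℕ → Bool
withPredecessor S zero    = false
withPredecessor S (suc k) = S k (suc k)

letterOf : (ℕ → ℕ → Bool) → ℕ → ℕ → Letter
letterOf S n i = letterFrom (S 0 i) (S (firstOutside S n) i) (withPredecessor S i)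

withPredecessor-cong : ∀ S S' n → (∀ i j → i < n → j < n → S i j ≡ S' i j) →
                       ∀ i → i < n → withPredecessor S i ≡ withPredecessor S' i
withPredecessor-cong S S' n h zero    _   = refl
withPredecessor-cong S S' n h (suc k) k<n = h k (suc k) (<-trans ≤-refl k<n) k<n

letterOf-cong : ∀ S S' n → (∀ i j → i < n → j < n → S i j ≡ S' i j) →
                ∀ i → i < n → letterOf S n i ≡ letterOf S' n i
letterOf-cong S S' n h i i<n
  rewrite firstTrue-cong (λ k → not (S 0 k)) (λ k → not (S' 0 k)) n (λ k k<n → cong not (h 0 k (≤-<-trans z≤n i<n) k<n))
        | h 0 i (≤-<-trans z≤n i<n) i<n
        | withPredecessor-cong S S' n h i i<n
  with S' 0 i in e
... | true  = refl
... | false rewrite h (firstOutside S' n) i (≤-<-trans (firstTrue-≤ (λ k → not (S' 0 k)) n i i<n (cong not e)) i<n) i<n = refl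

≡ᵇ-true : ∀ {m n} → m ≡ n → (m ≡ᵇ n) ≡ true
≡ᵇ-true {m} refl = Equivalence.to T-≡ (≡⇒≡ᵇ m m refl)

≡ᵇ-false : ∀ {m n} → m ≢ n → (m ≡ᵇ n) ≡ false
≡ᵇ-false {m} {n} m≢n with m ≡ᵇ n in e
... | false = refl
... | true  = ⊥-elim (m≢n (≡ᵇ⇒≡ m n (subst T (sym e) tt)))

≡ᵇ-reflects : ∀ {m n} b → (m ≡ n → b ≡ true) → (b ≡ true → m ≡ n) → (m ≡ᵇ n) ≡ b
≡ᵇ-reflects true  _  from = ≡ᵇ-true (from refl)
≡ᵇ-reflects false to _    = ≡ᵇ-false λ e → case to e of λ ()

module WordOfRelation (n : ℕ) (S : ℕ → ℕ → Bool)
    (S-refl : ∀ i → i < n → S i i ≡ true)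
    (S-sym : ∀ i j → S i j ≡ S j i)
    (S-trans : ∀ i j k → S i j ≡ true → S j k ≡ true → S i k ≡ true)
    (no-occurrence : ∀ a b c d → a < b → b < c → c < d → d < n →
                     S a b ≡ false → S a c ≡ false → S b c ≡ false → S b d ≡ true → ⊥) where

  W : ℕ → Letter
  W = letterOf S n

  f : ℕ
  f = firstOutside S n

  apart : ∀ x y z → S x y ≡ true → S x z ≡ false → S y z ≡ false
  apart x y z xy xz with S y z in yz
  ... | false = refl
  ... | true  = trans (sym (S-trans x y z xy yz)) xz

  sym-false : ∀ x y → S x y ≡ false → S y x ≡ false
  sym-false x y e = trans (S-sym y x) e

  sym-true : ∀ x y → S x y ≡ true → S y x ≡ true
  sym-true x y e = trans (S-sym y x) e

  W-A⁻ : ∀ i → S 0 i ≡ true → W i ≡ A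
  W-A⁻ i e rewrite e = refl

  W-B⁻ : ∀ i → S 0 i ≡ false → S f i ≡ true → W i ≡ B
  W-B⁻ i e e' rewrite e | e' = refl

  W-outer⁻ : ∀ i → S 0 i ≡ false → S f i ≡ false → Outer (W i)
  W-outer⁻ i e e' rewrite e | e' = letterFrom-false-false (withPredecessor S i)

  W-A : ∀ i → W i ≡ A → S 0 i ≡ true
  W-A i = letterFrom-A (S 0 i) _ _

  W-B : ∀ i → W i ≡ B → S 0 i ≡ false × S f i ≡ true
  W-B i = letterFrom-B (S 0 i) (S f i) _

  W-outer : ∀ i → Outer (W i) → S 0 i ≡ false × S f i ≡ false
  W-outer i = letterFrom-outer (S 0 i) (S f i) _

  W-C : ∀ i → W i ≡ C → withPredecessor S i ≡ true
  W-C i = letterFrom-C (S 0 i) (S f i) _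

  W-N : ∀ i → W i ≡ N → withPredecessor S i ≡ false
  W-N i = letterFrom-N (S 0 i) (S f i) _

  f-≤ : ∀ i → i < n → S 0 i ≡ false → f ≤ i
  f-≤ i i<n e = firstTrue-≤ (λ k → not (S 0 k)) n i i<n (cong not e)

  f-outside : ∀ i → i < n → S 0 i ≡ false → S 0 f ≡ false
  f-outside i i<n e with S 0 f | firstTrue-found (λ k → not (S 0 k)) n (≤-<-trans (f-≤ i i<n e) i<n)
  ... | false | _ = refl

  0<f : ∀ i → i < n → S 0 i ≡ false → 0 < f
  0<f i i<n e with f in f≡
  ... | suc _ = s≤s z≤n
  ... | zero  =
    case trans (sym (S-refl 0 (≤-<-trans z≤n i<n))) (subst (λ x → S 0 x ≡ false) f≡ (f-outside i i<n e)) of λ ()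

  f<outer : ∀ i → i < n → Outer (W i) → f < i
  f<outer i i<n o with W-outer i o
  ... | e , e' with m≤n⇒m<n∨m≡n (f-≤ i i<n e)
  ... | inj₁ f<i  = f<i
  ... | inj₂ refl = case trans (sym (S-refl f i<n)) e' of λ ()

  W-f : ∀ i → i < n → S 0 i ≡ false → W f ≡ B
  W-f i i<n e = W-B⁻ f (f-outside i i<n e) (S-refl f (≤-<-trans (f-≤ i i<n e) i<n))

  0<outer : ∀ i → i < n → Outer (W i) → 0 < i
  0<outer zero    0<n o = case trans (sym (S-refl 0 0<n)) (proj₁ (W-outer 0 o)) of λ ()
  0<outer (suc i) _   _ = s≤s z≤n

  starts-A : 0 < n → W 0 ≡ A
  starts-A 0<n = W-A⁻ 0 (S-refl 0 0<n)

  outer⇒earlier-B : ∀ i → i < n → Outer (W i) → ∃ λ j → j < i × W j ≡ B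
  outer⇒earlier-B i i<n o = f , f<outer i i<n o , W-f i i<n (proj₁ (W-outer i o))

  C⇒follows-outer : ∀ i → i < n → W i ≡ C → ∃ λ k → i ≡ suc k × Outer (W k)
  C⇒follows-outer zero    _     e = case W-C 0 e of λ ()
  C⇒follows-outer (suc k) 1+k<n e =
    k , refl , W-outer⁻ k (related-apart 0 (proj₁ outside)) (related-apart f (proj₂ outside))
    where
    outside = W-outer (suc k) (subst Outer (sym e) tt)
    related-apart : ∀ x → S x (suc k) ≡ false → S x k ≡ false
    related-apart x e' with S x k in xk
    ... | false = refl
    ... | true  = trans (sym (S-trans x k (suc k) xk (W-C (suc k) e))) e'

  no-outer-B : ∀ i j → i < j → j < n → Outer (W i) → W j ≡ B → ⊥
  no-outer-B i j i<j j<n o eB =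
    no-occurrence 0 f i j (0<f i i<n e0i) (f<outer i i<n o) i<j j<n (f-outside i i<n e0i) e0i efi (proj₂ (W-B j eB))
    where
    i<n = <-trans i<j j<n
    e0i = proj₁ (W-outer i o)
    efi = proj₂ (W-outer i o)

  no-B-A-outer-A : ∀ a b c d → a < b → b < c → c < d → d < n →
                   W a ≡ B → W b ≡ A → Outer (W c) → W d ≡ A → ⊥
  no-B-A-outer-A a b c d a<b b<c c<d d<n ea eb oc ed =
    no-occurrence a b c d a<b b<c c<d d<n
      (sym-false b a (apart 0 b a b0 (proj₁ (W-B a ea)))) (apart f a c (proj₂ (W-B a ea)) (proj₂ (W-outer c oc)))
      (apart 0 b c b0 (proj₁ (W-outer c oc))) (S-trans b 0 d (sym-true 0 b b0) (W-A d ed))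
    where b0 = W-A b eb

  no-outer-A-outer-A : ∀ a b c d → a < b → b < c → c < d → d < n →
                       Outer (W a) → W b ≡ A → Outer (W c) → W d ≡ A → ⊥
  no-outer-A-outer-A a b c d a<b b<c c<d d<n oa eb oc ed =
    no-occurrence f b c d (<-trans (f<outer a a<n oa) a<b) b<c c<d d<n
      (sym-false b f (apart 0 b f b0 (f-outside a a<n (proj₁ (W-outer a oa))))) (proj₂ (W-outer c oc))
      (apart 0 b c b0 (proj₁ (W-outer c oc))) (S-trans b 0 d (sym-true 0 b b0) (W-A d ed))
    where
    a<n = <-trans a<b (<-trans b<c (<-trans c<d d<n))
    b0 = W-A b eb

  admissible : Admissible W n
  admissible = record
    { starts-A = starts-A ; outer⇒earlier-B = outer⇒earlier-B ; C⇒follows-outer = C⇒follows-outer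
    ; no-outer-B = no-outer-B ; no-B-A-outer-A = no-B-A-outer-A ; no-outer-A-outer-A = no-outer-A-outer-A }

  open Labels admissible using (run-interval)

  runStart-related : ∀ i → i < n → Outer (W i) → S (runStart W i) i ≡ true
  runStart-related zero    0<n   o = ⊥-elim (<-irrefl refl (0<outer 0 0<n o))
  runStart-related (suc k) 1+k<n o with W (suc k) in e
  ... | A = ⊥-elim o
  ... | B = ⊥-elim o
  ... | N = S-refl (suc k) 1+k<n
  ... | C with C⇒follows-outer (suc k) 1+k<n e
  ... | .k , refl , o' =
    S-trans (runStart W k) k (suc k) (runStart-related k (<-trans ≤-refl 1+k<n) o') (W-C (suc k) e)

  runStart-fixed⇒N : ∀ r → r < n → Outer (W r) → runStart W r ≡ r → W r ≡ N
  runStart-fixed⇒N zero    0<n o _ = ⊥-elim (<-irrefl refl (0<outer 0 0<n o))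
  runStart-fixed⇒N (suc c) _   o e with W (suc c)
  ... | A = ⊥-elim o
  ... | B = ⊥-elim o
  ... | N = refl
  ... | C = ⊥-elim (<-irrefl e (s≤s (runStart-≤ W c)))

  -- c = runStart W j − 1 lies between i and j outside their block, and 0 or f completes a 1/24/3.
  no-crossing : ∀ i j c → i < j → j < n → Outer (W i) → Outer (W j) → S i j ≡ true →
                runStart W j ≡ suc c → i ≤ c → ⊥
  no-crossing i j c i<j j<n oi oj i~j r≡1+c i≤c = crossing (m≤n⇒m<n∨m≡n i≤c)
    where
    i<n = <-trans i<j j<n
    r≤j : suc c ≤ j
    r≤j = subst (_≤ j) r≡1+c (runStart-≤ W j)
    r-run = run-interval j j<n oj (suc c) (subst (_≤ suc c) (sym r≡1+c) ≤-refl) r≤j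
    c≁r : S c (suc c) ≡ false
    c≁r = W-N (suc c) (runStart-fixed⇒N (suc c) (≤-<-trans r≤j j<n) (proj₁ r-run) (trans (proj₂ r-run) r≡1+c))
    i~r : S i (suc c) ≡ true
    i~r = S-trans i j (suc c) i~j (sym-true (suc c) j (subst (λ x → S x j ≡ true) r≡1+c (runStart-related j j<n oj)))
    i≁c : S i c ≡ false
    i≁c = apart (suc c) i c (sym-true i (suc c) i~r) (sym-false c (suc c) c≁r)
    crossing : i < c ⊎ i ≡ c → ⊥
    crossing (inj₂ i≡c) = case trans (sym (subst (λ x → S x (suc c) ≡ true) i≡c i~r)) c≁r of λ ()
    crossing (inj₁ i<c) with S 0 c in 0~c
    ... | false = no-occurrence 0 i c j (0<outer i i<n oi) i<c (<-≤-trans ≤-refl r≤j) j<n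
                    (proj₁ (W-outer i oi)) 0~c i≁c i~j
    ... | true  = no-occurrence f i c j (f<outer i i<n oi) i<c (<-≤-trans ≤-refl r≤j) j<n
                    (proj₂ (W-outer i oi)) (sym-false c f (apart 0 c f 0~c (f-outside i i<n (proj₁ (W-outer i oi))))) i≁c i~j

  related⇒runStart-≤ : ∀ i j → i < j → j < n → Outer (W i) → Outer (W j) → S i j ≡ true → runStart W j ≤ i
  related⇒runStart-≤ i j i<j j<n oi oj i~j with runStart W j ≤? i
  ... | yes r≤i = r≤i
  ... | no  r≰i with runStart W j in r≡ | ≰⇒> r≰i
  ... | suc c | s≤s i≤c = ⊥-elim (no-crossing i j c i<j j<n oi oj i~j r≡ i≤c)

  related⇒same-runStart : ∀ i j → i < n → j < n → Outer (W i) → Outer (W j) → S i j ≡ true →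
                          runStart W i ≡ runStart W j
  related⇒same-runStart i j i<n j<n oi oj i~j with <-cmp i j
  ... | tri≈ _ refl _ = refl
  ... | tri< i<j _ _ = proj₂ (run-interval j j<n oj i (related⇒runStart-≤ i j i<j j<n oi oj i~j) (<⇒≤ i<j))
  ... | tri> _ _ j<i =
    sym (proj₂ (run-interval i i<n oi j (related⇒runStart-≤ j i j<i i<n oj oi (sym-true i j i~j)) (<⇒≤ j<i)))

  same-label⇒related : ∀ i j → i < n → j < n → blockLabel W i ≡ blockLabel W j → S i j ≡ true
  same-label⇒related i j i<n j<n e with labelOf-injective (W i) (W j) _ _ e
  ... | inj₁ (ei , ej)               = S-trans i 0 j (sym-true 0 i (W-A i ei)) (W-A j ej)
  ... | inj₂ (inj₁ (ei , ej))        = S-trans i f j (sym-true f i (proj₂ (W-B i ei))) (proj₂ (W-B j ej))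
  ... | inj₂ (inj₂ (oi , oj , r≡r')) =
    S-trans i (runStart W i) j (sym-true _ i (runStart-related i i<n oi))
      (subst (λ x → S x j ≡ true) (sym r≡r') (runStart-related j j<n oj))

  unrelated-trans : ∀ x i j → S x i ≡ false → S i j ≡ true → S x j ≡ false
  unrelated-trans x i j x≁i i~j = sym-false j x (apart i j x i~j (sym-false x i x≁i))

  related⇒same-label : ∀ i j → i < n → j < n → S i j ≡ true → blockLabel W i ≡ blockLabel W j
  related⇒same-label i j i<n j<n i~j with classify (W i)
  ... | inj₁ ei = trans (labelOf-A _ ei) (sym (labelOf-A _ (W-A⁻ j (S-trans 0 i j (W-A i ei) i~j))))
  ... | inj₂ (inj₁ ei) = trans (labelOf-B _ ei) (sym (labelOf-B _ (W-B⁻ j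
          (unrelated-trans 0 i j (proj₁ (W-B i ei)) i~j) (S-trans f i j (proj₂ (W-B i ei)) i~j))))
  ... | inj₂ (inj₂ oi) = begin
    blockLabel W i    ≡⟨ labelOf-outer (W i) _ oi ⟩
    2 + runStart W i  ≡⟨ cong (2 +_) (related⇒same-runStart i j i<n j<n oi oj i~j) ⟩
    2 + runStart W j  ≡⟨ labelOf-outer (W j) _ oj ⟨
    blockLabel W j    ∎
    where
    open ≡-Reasoning
    oj = W-outer⁻ j (unrelated-trans 0 i j (proj₁ (W-outer i oi)) i~j) (unrelated-trans f i j (proj₂ (W-outer i oi)) i~j)

  labels-represent : ∀ i j → i < n → j < n → (blockLabel W i ≡ᵇ blockLabel W j) ≡ S i j
  labels-represent i j i<n j<n =
    ≡ᵇ-reflects (S i j) (same-label⇒related i j i<n j<n) (related⇒same-label i j i<n j<n)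

module LabelRelation {w : ℕ → Letter} {n : ℕ} (adm : Admissible w n) where
  open Admissible adm
  open Labels adm using (ℓ)

  R : ℕ → ℕ → Bool
  R i j = ℓ i ≡ᵇ ℓ j

  ℓ-0 : 0 < n → ℓ 0 ≡ 0
  ℓ-0 0<n = labelOf-A _ (starts-A 0<n)

  R-0-A : ∀ i → i < n → w i ≡ A → R 0 i ≡ true
  R-0-A i i<n e = ≡ᵇ-true (trans (ℓ-0 (≤-<-trans z≤n i<n)) (sym (labelOf-A _ e)))

  R-0-A⁻ : ∀ i → i < n → R 0 i ≡ true → w i ≡ A
  R-0-A⁻ i i<n e = labelOf-zero⁻ (w i) _ (trans (sym (≡ᵇ⇒≡ _ _ (subst T (sym e) tt))) (ℓ-0 (≤-<-trans z≤n i<n)))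

  R-0-nonA : ∀ i → i < n → w i ≢ A → R 0 i ≡ false
  R-0-nonA i i<n ¬A with R 0 i in e
  ... | false = refl
  ... | true  = ⊥-elim (¬A (R-0-A⁻ i i<n e))

  f : ℕ
  f = firstOutside R n

  outsideA : ℕ → Bool
  outsideA k = not (R 0 k)

  f-≤ : ∀ i → i < n → w i ≢ A → f ≤ i
  f-≤ i i<n ¬A = firstTrue-≤ outsideA n i i<n (cong not (R-0-nonA i i<n ¬A))

  before-f : ∀ k → k < f → k < n → w k ≡ A
  before-f k k<f k<n with R 0 k in e | firstTrue-minimal outsideA n k k<f
  ... | true  | _ = R-0-A⁻ k k<n e

  f-B : f < n → w f ≡ B
  f-B f<n with classify (w f)
  ... | inj₂ (inj₁ eB) = eB
  ... | inj₁ eA = case trans (sym (firstTrue-found outsideA n f<n)) (cong not (R-0-A f f<n eA)) of λ ()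
  ... | inj₂ (inj₂ o) with outer⇒earlier-B f f<n o
  ... | j , j<f , eB = case trans (sym (before-f j j<f (<-trans j<f f<n))) eB of λ ()

  f<n : ∀ i → i < n → w i ≢ A → f < n
  f<n i i<n ¬A = ≤-<-trans (f-≤ i i<n ¬A) i<n

  R-B : ∀ i → i < n → w i ≡ B → R f i ≡ true
  R-B i i<n eB = ≡ᵇ-true (trans (labelOf-B _ (f-B (f<n i i<n ¬A))) (sym (labelOf-B _ eB)))
    where ¬A = λ eA → case trans (sym eB) eA of λ ()

  R-outer : ∀ i → i < n → Outer (w i) → R f i ≡ false
  R-outer i i<n o = ≡ᵇ-false λ e →
    case trans (sym (labelOf-B _ (f-B (f<n i i<n (λ eA → A-not-outer eA o))))) (trans e (labelOf-outer _ _ o)) of λ ()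

  R-C : ∀ k → suc k < n → w (suc k) ≡ C → R k (suc k) ≡ true
  R-C k 1+k<n e with C⇒follows-outer (suc k) 1+k<n e
  ... | .k , refl , o = ≡ᵇ-true (begin
    ℓ k                          ≡⟨ labelOf-outer (w k) _ o ⟩
    2 + runStart w k             ≡⟨ cong (2 +_) runStart-C ⟨
    2 + runStart w (suc k)       ≡⟨ labelOf-outer (w (suc k)) _ (subst Outer (sym e) tt) ⟨
    ℓ (suc k)                    ∎)
    where
    open ≡-Reasoning
    runStart-C : runStart w (suc k) ≡ runStart w k
    runStart-C rewrite e = refl

  R-N : ∀ k → w (suc k) ≡ N → R k (suc k) ≡ false
  R-N k e = ≡ᵇ-false λ ℓk≡ℓ1+k → <-irrefl ℓk≡ℓ1+k (begin-strict
    ℓ k                          ≤⟨ blockLabel-≤ w k ⟩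
    2 + k                        <⟨ ≤-refl ⟩
    2 + suc k                    ≡⟨ cong (2 +_) (runStart-N w (suc k) e) ⟨
    2 + runStart w (suc k)       ≡⟨ labelOf-outer (w (suc k)) _ (subst Outer (sym e) tt) ⟨
    ℓ (suc k)                    ∎)
    where open ≤-Reasoning

  outer-letter : ∀ k → suc k < n → ∀ x → w (suc k) ≡ x → Outer x → letterFrom false false (R k (suc k)) ≡ x
  outer-letter k 1+k<n C e _ rewrite R-C k 1+k<n e = refl
  outer-letter k 1+k<n N e _ rewrite R-N k e = refl

  letters-recovered : ∀ i → i < n → letterOf R n i ≡ w i
  letters-recovered i i<n with classify (w i)
  ... | inj₁ eA rewrite R-0-A i i<n eA = sym eA
  ... | inj₂ (inj₁ eB) rewrite R-0-nonA i i<n (λ eA → case trans (sym eB) eA of λ ()) | R-B i i<n eB = sym eB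
  ... | inj₂ (inj₂ o) rewrite R-0-nonA i i<n (λ eA → A-not-outer eA o) | R-outer i i<n o = outer-at i i<n o
    where
    outer-at : ∀ i → i < n → Outer (w i) → letterFrom false false (withPredecessor R i) ≡ w i
    outer-at zero    0<n   o = ⊥-elim (A-not-outer (starts-A 0<n) o)
    outer-at (suc k) 1+k<n o = outer-letter k 1+k<n (w (suc k)) refl o

-- Partitions as relations on ℕ

-- The equivalence proof of a set partition is irrelevant, but T is decidable, so each law can be recomputed.
rel-refl : ∀ {n} (π : SetPartition n) x → lookup (lookup (rel π) x) x ≡ true
rel-refl (mkSP M eq) x = Equivalence.to T-≡ (recompute (T? _) (IsEquivalence.refl eq {x}))

rel-sym : ∀ {n} (π : SetPartition n) x y → lookup (lookup (rel π) x) y ≡ true → lookup (lookup (rel π) y) x ≡ true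
rel-sym (mkSP M eq) x y e =
  Equivalence.to T-≡ (recompute (T? _) (IsEquivalence.sym eq {x} {y} (Equivalence.from T-≡ e)))

rel-trans : ∀ {n} (π : SetPartition n) x y z →
            lookup (lookup (rel π) x) y ≡ true → lookup (lookup (rel π) y) z ≡ true → lookup (lookup (rel π) x) z ≡ true
rel-trans (mkSP M eq) x y z e e' =
  Equivalence.to T-≡ (recompute (T? _) (IsEquivalence.trans eq {x} {y} {z} (Equivalence.from T-≡ e) (Equivalence.from T-≡ e')))

module PartitionRelation {n} (π : SetPartition n) where

  E : Fin n → Fin n → Bool
  E x y = lookup (lookup (rel π) x) y

  E-sym : ∀ x y → E x y ≡ E y x
  E-sym x y with E x y in xy | E y x in yx
  ... | true  | true  = refl
  ... | false | false = refl
  ... | true  | false = trans (sym (rel-sym π x y xy)) yx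
  ... | false | true  = trans (sym xy) (rel-sym π y x yx)

  S : ℕ → ℕ → Bool
  S i j with i <? n | j <? n
  ... | yes i<n | yes j<n = E (fromℕ< i<n) (fromℕ< j<n)
  ... | _       | _       = false

  S-fromℕ< : ∀ i j (i<n : i < n) (j<n : j < n) → S i j ≡ E (fromℕ< i<n) (fromℕ< j<n)
  S-fromℕ< i j i<n j<n with i <? n | j <? n
  ... | yes _ | yes _ = refl
  ... | no ¬p | _     = ⊥-elim (¬p i<n)
  ... | yes _ | no ¬q = ⊥-elim (¬q j<n)

  S-toℕ : ∀ x y → S (toℕ x) (toℕ y) ≡ E x y
  S-toℕ x y = trans (S-fromℕ< _ _ (toℕ<n x) (toℕ<n y)) (cong₂ E (fromℕ<-toℕ x _) (fromℕ<-toℕ y _))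

  S-refl : ∀ i → i < n → S i i ≡ true
  S-refl i i<n = trans (S-fromℕ< i i i<n i<n) (rel-refl π _)

  S-sym : ∀ i j → S i j ≡ S j i
  S-sym i j with i <? n | j <? n
  ... | yes _ | yes _ = E-sym _ _
  ... | yes _ | no  _ = refl
  ... | no  _ | yes _ = refl
  ... | no  _ | no  _ = refl

  S-trans : ∀ i j k → S i j ≡ true → S j k ≡ true → S i k ≡ true
  S-trans i j k with i <? n | j <? n | k <? n
  ... | yes _ | yes _ | yes _ = rel-trans π _ _ _
  ... | yes _ | yes _ | no  _ = λ _ ()
  ... | yes _ | no  _ | _     = λ ()
  ... | no  _ | _     | _     = λ ()

  occurrenceFin : ∀ (xa xb xc xd : Fin n) → toℕ xa < toℕ xb → toℕ xb < toℕ xc → toℕ xc < toℕ xd →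
                  E xa xb ≡ false → E xa xc ≡ false → E xb xc ≡ false → E xb xd ≡ true → Contains π τ-1/24/3
  occurrenceFin xa xb xc xd ab bc cd a≁b a≁c b≁c b~d = g , increasing , same-blocks
    where
    g : Fin 4 → Fin n
    g zero                   = xa
    g (suc zero)             = xb
    g (suc (suc zero))       = xc
    g (suc (suc (suc zero))) = xd
    increasing : ∀ i j → i Fin.< j → g i Fin.< g j
    increasing zero (suc zero) _ = ab
    increasing zero (suc (suc zero)) _ = <-trans ab bc
    increasing zero (suc (suc (suc zero))) _ = <-trans ab (<-trans bc cd)
    increasing (suc zero) (suc (suc zero)) _ = bc
    increasing (suc zero) (suc (suc (suc zero))) _ = <-trans bc cd
    increasing (suc (suc zero)) (suc (suc (suc zero))) _ = cd
    increasing zero zero ()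
    increasing (suc zero) zero ()
    increasing (suc zero) (suc zero) (s≤s ())
    increasing (suc (suc zero)) zero ()
    increasing (suc (suc zero)) (suc zero) (s≤s ())
    increasing (suc (suc zero)) (suc (suc zero)) (s≤s (s≤s ()))
    increasing (suc (suc (suc zero))) zero ()
    increasing (suc (suc (suc zero))) (suc zero) (s≤s ())
    increasing (suc (suc (suc zero))) (suc (suc zero)) (s≤s (s≤s ()))
    increasing (suc (suc (suc zero))) (suc (suc (suc zero))) (s≤s (s≤s (s≤s ())))
    flip : ∀ x y → E x y ≡ false → E y x ≡ false
    flip x y e = trans (E-sym y x) e
    apart : ∀ x y z → E x y ≡ true → E x z ≡ false → E y z ≡ false
    apart x y z xy xz with E y z in yz
    ... | false = refl
    ... | true  = trans (sym (rel-trans π x y z xy yz)) xz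
    a≁d : E xa xd ≡ false
    a≁d = flip xd xa (apart xb xd xa b~d (flip xa xb a≁b))
    c≁d : E xc xd ≡ false
    c≁d = flip xd xc (apart xb xd xc b~d b≁c)
    same-blocks : ∀ i j → E (g i) (g j) ≡ lookup (lookup (rel τ-1/24/3) i) j
    same-blocks zero zero = rel-refl π xa
    same-blocks zero (suc zero) = a≁b
    same-blocks zero (suc (suc zero)) = a≁c
    same-blocks zero (suc (suc (suc zero))) = a≁d
    same-blocks (suc zero) zero = flip xa xb a≁b
    same-blocks (suc zero) (suc zero) = rel-refl π xb
    same-blocks (suc zero) (suc (suc zero)) = b≁c
    same-blocks (suc zero) (suc (suc (suc zero))) = b~d
    same-blocks (suc (suc zero)) zero = flip xa xc a≁c
    same-blocks (suc (suc zero)) (suc zero) = flip xb xc b≁c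
    same-blocks (suc (suc zero)) (suc (suc zero)) = rel-refl π xc
    same-blocks (suc (suc zero)) (suc (suc (suc zero))) = c≁d
    same-blocks (suc (suc (suc zero))) zero = flip xa xd a≁d
    same-blocks (suc (suc (suc zero))) (suc zero) = rel-sym π xb xd b~d
    same-blocks (suc (suc (suc zero))) (suc (suc zero)) = flip xc xd c≁d
    same-blocks (suc (suc (suc zero))) (suc (suc (suc zero))) = rel-refl π xd

  occurrence : ∀ a b c d → a < b → b < c → c < d → d < n →
               S a b ≡ false → S a c ≡ false → S b c ≡ false → S b d ≡ true → Contains π τ-1/24/3
  occurrence a b c d a<b b<c c<d d<n a≁b a≁c b≁c b~d =
    occurrenceFin (fromℕ< a<n) (fromℕ< b<n) (fromℕ< c<n) (fromℕ< d<n)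
      (subst₂ _<_ (sym (toℕ-fromℕ< a<n)) (sym (toℕ-fromℕ< b<n)) a<b)
      (subst₂ _<_ (sym (toℕ-fromℕ< b<n)) (sym (toℕ-fromℕ< c<n)) b<c)
      (subst₂ _<_ (sym (toℕ-fromℕ< c<n)) (sym (toℕ-fromℕ< d<n)) c<d)
      (trans (sym (S-fromℕ< a b a<n b<n)) a≁b) (trans (sym (S-fromℕ< a c a<n c<n)) a≁c)
      (trans (sym (S-fromℕ< b c b<n c<n)) b≁c) (trans (sym (S-fromℕ< b d b<n d<n)) b~d)
    where
    c<n = <-trans c<d d<n
    b<n = <-trans b<c c<n
    a<n = <-trans a<b b<n

-- Avoiding partitions correspond to accepted words

Admissible-cong : ∀ {w w' n} → (∀ i → i < n → w i ≡ w' i) → Admissible w n → Admissible w' n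
Admissible-cong {w} {w'} {n} w≗w' adm = record
  { starts-A = λ 0<n → trans (sym (w≗w' 0 0<n)) (starts-A 0<n)
  ; outer⇒earlier-B = λ i i<n o → case outer⇒earlier-B i i<n (outer← i<n o) of λ where
      (j , j<i , eB) → j , j<i , trans (sym (w≗w' j (<-trans j<i i<n))) eB
  ; C⇒follows-outer = λ i i<n eC → case C⇒follows-outer i i<n (trans (w≗w' i i<n) eC) of λ where
      (k , refl , o) → k , refl , subst Outer (w≗w' k (<-trans ≤-refl i<n)) o
  ; no-outer-B = λ i j i<j j<n o eB → no-outer-B i j i<j j<n (outer← (<-trans i<j j<n) o) (trans (w≗w' j j<n) eB)
  ; no-B-A-outer-A = λ a b c d a<b b<c c<d d<n eB eA o eA' →
      no-B-A-outer-A a b c d a<b b<c c<d d<n (trans (w≗w' a (a<n a<b b<c c<d d<n)) eB)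
        (trans (w≗w' b (b<n b<c c<d d<n)) eA) (outer← (<-trans c<d d<n) o) (trans (w≗w' d d<n) eA')
  ; no-outer-A-outer-A = λ a b c d a<b b<c c<d d<n o eA o' eA' →
      no-outer-A-outer-A a b c d a<b b<c c<d d<n (outer← (a<n a<b b<c c<d d<n) o)
        (trans (w≗w' b (b<n b<c c<d d<n)) eA) (outer← (<-trans c<d d<n) o') (trans (w≗w' d d<n) eA')
  }
  where
  open Admissible adm
  outer← : ∀ {i} → i < n → Outer (w' i) → Outer (w i)
  outer← {i} i<n = subst Outer (sym (w≗w' i i<n))
  b<n : ∀ {b c d} → b < c → c < d → d < n → b < n
  b<n b<c c<d d<n = <-trans b<c (<-trans c<d d<n)
  a<n : ∀ {a b c d} → a < b → b < c → c < d → d < n → a < n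
  a<n a<b b<c c<d d<n = <-trans a<b (b<n b<c c<d d<n)

runStart-cong : ∀ w w' i → (∀ k → k ≤ i → w k ≡ w' k) → runStart w i ≡ runStart w' i
runStart-cong w w' zero    _    = refl
runStart-cong w w' (suc i) w≗w' rewrite w≗w' (suc i) ≤-refl with w' (suc i)
... | A = refl
... | B = refl
... | C = runStart-cong w w' i (λ k k≤i → w≗w' k (m≤n⇒m≤1+n k≤i))
... | N = refl

blockLabel-cong : ∀ w w' i → (∀ k → k ≤ i → w k ≡ w' k) → blockLabel w i ≡ blockLabel w' i
blockLabel-cong w w' i w≗w' rewrite w≗w' i ≤-refl | runStart-cong w w' i w≗w' = refl

at-tabulate : ∀ {n} (h : ℕ → Letter) i → i < n → at (tabulate {n = n} (h ∘ toℕ)) i ≡ h i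
at-tabulate {suc n} h zero    _         = refl
at-tabulate {suc n} h (suc i) (s≤s i<n) = at-tabulate {n} (h ∘ suc) i i<n

tabulate-at : ∀ {n} (v : Vec Letter n) → tabulate (at v ∘ toℕ) ≡ v
tabulate-at []      = refl
tabulate-at (x ∷ v) = cong (x ∷_) (tabulate-at v)

Accepted : State → ℕ → Set
Accepted q n = Σ (Vec Letter n) (λ v → T (live (run q v)))

partitionOf : ∀ {n} → Vec Letter n → SetPartition n
partitionOf v = fromLabels (blockLabel (at v) ∘ toℕ)

partitionOf-rel : ∀ {n} (v : Vec Letter n) x y →
                  lookup (lookup (rel (partitionOf v)) x) y ≡ (blockLabel (at v) (toℕ x) ≡ᵇ blockLabel (at v) (toℕ y))
partitionOf-rel v x y = trans (cong (λ r → lookup r y) (lookup∘tabulate _ x)) (lookup∘tabulate _ y)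

partitionOf-avoids : ∀ {n} (v : Vec Letter n) → T (live (run q0 v)) → ¬ Contains (partitionOf v) τ-1/24/3
partitionOf-avoids v acc (g , increasing , same-blocks) =
  labels-avoid (toℕ (g 0F)) (toℕ (g 1F)) (toℕ (g 2F)) (toℕ (g 3F))
    (increasing 0F 1F (s≤s z≤n)) (increasing 1F 2F (s≤s (s≤s z≤n))) (increasing 2F 3F (s≤s (s≤s (s≤s z≤n))))
    (toℕ<n (g 3F))
    (≡ᵇ⇒≡ _ _ (Equivalence.from T-≡ (trans (sym (partitionOf-rel v (g 1F) (g 3F))) (same-blocks 1F 3F))))
    (different 0F 1F refl) (different 0F 2F refl) (different 1F 2F refl)
  where
  open Labels (AcceptedWord.admissible v acc)
  0F 1F 2F 3F : Fin 4
  0F = zero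
  1F = suc zero
  2F = suc (suc zero)
  3F = suc (suc (suc zero))
  different : ∀ i j → lookup (lookup (rel τ-1/24/3) i) j ≡ false → ℓ (toℕ (g i)) ≢ ℓ (toℕ (g j))
  different i j e eq =
    case trans (sym (≡ᵇ-true eq)) (trans (sym (partitionOf-rel v (g i) (g j))) (trans (same-blocks i j) e)) of λ ()

wordOf : ∀ {n} → SetPartition n → Vec Letter n
wordOf {n} π = tabulate (letterOf (PartitionRelation.S π) n ∘ toℕ)

module AvoidingPartition {n} (π : SetPartition n) .(avoids : ¬ Contains π τ-1/24/3) where
  open PartitionRelation π

  no-occurrence : ∀ a b c d → a < b → b < c → c < d → d < n →
                  S a b ≡ false → S a c ≡ false → S b c ≡ false → S b d ≡ true → ⊥
  no-occurrence a b c d a<b b<c c<d d<n a≁b a≁c b≁c b~d =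
    ⊥-elim-irr (avoids (occurrence a b c d a<b b<c c<d d<n a≁b a≁c b≁c b~d))

  open WordOfRelation n S S-refl S-sym S-trans no-occurrence

  W≗wordOf : ∀ i → i < n → W i ≡ at (wordOf π) i
  W≗wordOf i i<n = sym (at-tabulate W i i<n)

  wordOf-accepted : T (live (run q0 (wordOf π)))
  wordOf-accepted = AdmissibleWord.accepted (wordOf π) (Admissible-cong W≗wordOf admissible)

  wordOf-labels : ∀ x y → (blockLabel (at (wordOf π)) (toℕ x) ≡ᵇ blockLabel (at (wordOf π)) (toℕ y)) ≡ E x y
  wordOf-labels x y = begin
    (blockLabel (at (wordOf π)) (toℕ x) ≡ᵇ blockLabel (at (wordOf π)) (toℕ y))
      ≡⟨ cong₂ _≡ᵇ_ (label x) (label y) ⟩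
    (blockLabel W (toℕ x) ≡ᵇ blockLabel W (toℕ y))
      ≡⟨ labels-represent _ _ (toℕ<n x) (toℕ<n y) ⟩
    S (toℕ x) (toℕ y)
      ≡⟨ S-toℕ x y ⟩
    E x y
      ∎
    where
    open ≡-Reasoning
    label : ∀ x → blockLabel (at (wordOf π)) (toℕ x) ≡ blockLabel W (toℕ x)
    label x = blockLabel-cong _ W (toℕ x) (λ k k≤x → sym (W≗wordOf k (≤-<-trans k≤x (toℕ<n x))))

tabulate²-lookup : ∀ {n} (M : Vec (Vec Bool n) n) (f : Fin n → Fin n → Bool) →
                   (∀ x y → f x y ≡ lookup (lookup M x) y) → tabulate (λ x → tabulate (f x)) ≡ M
tabulate²-lookup M f f≗M =
  trans (tabulate-cong (λ x → trans (tabulate-cong (f≗M x)) (tabulate∘lookup (lookup M x)))) (tabulate∘lookup M)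

mkSP-cong : ∀ {n} {M M' : Vec (Vec Bool n) n} .{e e'} → M ≡ M' → mkSP M e ≡ mkSP M' e'
mkSP-cong refl = refl

partitionOf-wordOf : ∀ {n} (π : SetPartition n) .(avoids : ¬ Contains π τ-1/24/3) → partitionOf (wordOf π) ≡ π
partitionOf-wordOf (mkSP M e) avoids = mkSP-cong (tabulate²-lookup M _ (AvoidingPartition.wordOf-labels (mkSP M e) avoids))

wordOf-partitionOf : ∀ {n} (v : Vec Letter n) → T (live (run q0 v)) → wordOf (partitionOf v) ≡ v
wordOf-partitionOf {n} v acc =
  trans (tabulate-cong λ k → trans (letterOf-cong _ R n S≗R (toℕ k) (toℕ<n k)) (letters-recovered (toℕ k) (toℕ<n k)))
        (tabulate-at v)
  where
  open LabelRelation (AcceptedWord.admissible v acc)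
  open Labels (AcceptedWord.admissible v acc) using (ℓ)
  open PartitionRelation (partitionOf v) using (S; S-fromℕ<)
  S≗R : ∀ i j → i < n → j < n → S i j ≡ R i j
  S≗R i j i<n j<n = begin
    S i j
      ≡⟨ S-fromℕ< i j i<n j<n ⟩
    lookup (lookup (rel (partitionOf v)) (fromℕ< i<n)) (fromℕ< j<n)
      ≡⟨ partitionOf-rel v _ _ ⟩
    (ℓ (toℕ (fromℕ< i<n)) ≡ᵇ ℓ (toℕ (fromℕ< j<n)))
      ≡⟨ cong₂ (λ a b → ℓ a ≡ᵇ ℓ b) (toℕ-fromℕ< i<n) (toℕ-fromℕ< j<n) ⟩
    R i j
      ∎
    where open ≡-Reasoning

Accepted-≡ : ∀ {q n} {v v' : Vec Letter n} (acc : T (live (run q v))) (acc' : T (live (run q v'))) →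
             v ≡ v' → (v , acc) ≡ (v' , acc')
Accepted-≡ acc acc' refl = cong (_ ,_) (T-irrelevant acc acc')

avoiding↔accepted : ∀ n → Avoiding n τ-1/24/3 ↔ Accepted q0 n
avoiding↔accepted n = mk↔ₛ′ to from to-from from-to
  where
  to : Avoiding n τ-1/24/3 → Accepted q0 n
  to (mkAv π avoids) = wordOf π , AvoidingPartition.wordOf-accepted π avoids
  from : Accepted q0 n → Avoiding n τ-1/24/3
  from (v , acc) = mkAv (partitionOf v) (partitionOf-avoids v acc)
  to-from : ∀ y → to (from y) ≡ y
  to-from (v , acc) = Accepted-≡ _ acc (wordOf-partitionOf v acc)
  from-to : ∀ x → from (to x) ≡ x
  from-to (mkAv π avoids) = mkAv-cong (partitionOf-wordOf π avoids)
    where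
    mkAv-cong : ∀ {p p'} .{a a'} → p ≡ p' → mkAv {n} {4} {τ-1/24/3} p a ≡ mkAv p' a'
    mkAv-cong refl = refl

-- Counting accepted words

count : State → ℕ → ℕ
count q zero    = if live q then 1 else 0
count q (suc n) = count (δ q A) n + (count (δ q B) n + (count (δ q C) n + count (δ q N) n))

Fin-count-zero : ∀ q → Fin (count q 0) ↔ T (live q)
Fin-count-zero q with live q
... | true  = 1↔⊤
... | false = 0↔⊥

Accepted-zero : ∀ q → Accepted q 0 ↔ T (live q)
Accepted-zero q = mk↔ₛ′ (λ { ([] , acc) → acc }) ([] ,_) (λ _ → refl) (λ { ([] , _) → refl })

Accepted-suc : ∀ q n → Accepted q (suc n) ↔
               (Accepted (δ q A) n ⊎ (Accepted (δ q B) n ⊎ (Accepted (δ q C) n ⊎ Accepted (δ q N) n)))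
Accepted-suc q n = mk↔ₛ′ split join split-join join-split
  where
  split : Accepted q (suc n) → _
  split (A ∷ v , acc) = inj₁ (v , acc)
  split (B ∷ v , acc) = inj₂ (inj₁ (v , acc))
  split (C ∷ v , acc) = inj₂ (inj₂ (inj₁ (v , acc)))
  split (N ∷ v , acc) = inj₂ (inj₂ (inj₂ (v , acc)))
  join : _ → Accepted q (suc n)
  join (inj₁ (v , acc))                = A ∷ v , acc
  join (inj₂ (inj₁ (v , acc)))         = B ∷ v , acc
  join (inj₂ (inj₂ (inj₁ (v , acc))))  = C ∷ v , acc
  join (inj₂ (inj₂ (inj₂ (v , acc))))  = N ∷ v , acc
  split-join : ∀ y → split (join y) ≡ y
  split-join (inj₁ _)                = refl
  split-join (inj₂ (inj₁ _))         = refl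
  split-join (inj₂ (inj₂ (inj₁ _)))  = refl
  split-join (inj₂ (inj₂ (inj₂ _)))  = refl
  join-split : ∀ x → join (split x) ≡ x
  join-split (A ∷ _ , _) = refl
  join-split (B ∷ _ , _) = refl
  join-split (C ∷ _ , _) = refl
  join-split (N ∷ _ , _) = refl

count-correct : ∀ q n → Fin (count q n) ↔ Accepted q n
count-correct q zero    = ↔-trans (Fin-count-zero q) (↔-sym (Accepted-zero q))
count-correct q (suc n) =
  ↔-trans (↔-trans +↔⊎ (count-correct (δ q A) n ⊎-↔
          (↔-trans +↔⊎ (count-correct (δ q B) n ⊎-↔
          (↔-trans +↔⊎ (count-correct (δ q C) n ⊎-↔ count-correct (δ q N) n))))))
    (↔-sym (Accepted-suc q n))

count-dead : ∀ m → count dead m ≡ 0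
count-dead zero    = refl
count-dead (suc m) rewrite count-dead m = refl

count-q5 : ∀ m → count q5 m ≡ 2 ^ m
count-q5 zero    = refl
count-q5 (suc m) rewrite count-dead m | count-q5 m = cong (2 ^ m +_) (sym (+-identityʳ (2 ^ m)))

count-q7 : ∀ m → count q7 m ≡ 2 ^ m
count-q7 zero    = refl
count-q7 (suc m) rewrite count-dead m | count-q7 m = cong (2 ^ m +_) (sym (+-identityʳ (2 ^ m)))

count-q6 : ∀ m → count q6 m ≡ 2 ^ m
count-q6 zero    = refl
count-q6 (suc m) rewrite count-dead m | count-q6 m | count-q7 m = cong (2 ^ m +_) (sym (+-identityʳ (2 ^ m)))

count-q3≡q4 : ∀ m → count q3 m ≡ count q4 m
count-q3≡q4 zero    = refl
count-q3≡q4 (suc m) rewrite count-dead m | count-q5 m | count-q6 m | count-q3≡q4 m = step (count q4 m) (2 ^ m)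
  where
  step : ∀ x P → x + (x + P) ≡ P + (x + x)
  step = solve-∀

count-q4 : ∀ m → 2 * count q4 m ≡ (m + 2) * 2 ^ m
count-q4 zero    = refl
count-q4 (suc m) rewrite count-dead m | count-q6 m = begin
  2 * (2 ^ m + (count q4 m + count q4 m))  ≡⟨ distribute (count q4 m) (2 ^ m) ⟩
  2 * 2 ^ m + 2 * (2 * count q4 m)         ≡⟨ cong (λ y → 2 * 2 ^ m + 2 * y) (count-q4 m) ⟩
  2 * 2 ^ m + 2 * ((m + 2) * 2 ^ m)        ≡⟨ collect m (2 ^ m) ⟩
  (suc m + 2) * (2 * 2 ^ m)                ∎
  where
  open ≡-Reasoning
  distribute : ∀ x P → 2 * (P + (x + x)) ≡ 2 * P + 2 * (2 * x)
  distribute = solve-∀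
  collect : ∀ m P → 2 * P + 2 * ((m + 2) * P) ≡ (suc m + 2) * (2 * P)
  collect = solve-∀

count-q2 : ∀ m → count q2 m ≡ m * 2 ^ m + 1
count-q2 zero    = refl
count-q2 (suc m) rewrite count-dead m | count-q3≡q4 m | count-q2 m = begin
  count q4 m + (m * 2 ^ m + 1 + count q4 m)  ≡⟨ regroup (count q4 m) (m * 2 ^ m) ⟩
  2 * count q4 m + (m * 2 ^ m + 1)           ≡⟨ cong (_+ (m * 2 ^ m + 1)) (count-q4 m) ⟩
  (m + 2) * 2 ^ m + (m * 2 ^ m + 1)          ≡⟨ collect m (2 ^ m) ⟩
  suc m * (2 * 2 ^ m) + 1                    ∎
  where
  open ≡-Reasoning
  regroup : ∀ x y → x + (y + 1 + x) ≡ 2 * x + (y + 1)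
  regroup = solve-∀
  collect : ∀ m P → (m + 2) * P + (m * P + 1) ≡ suc m * (2 * P) + 1
  collect = solve-∀

count-q1 : ∀ m → count q1 m + 2 * 2 ^ m ≡ m * 2 ^ m + m + 3
count-q1 zero    = refl
count-q1 (suc m) rewrite count-dead m | count-q2 m = begin
  count q1 m + (m * 2 ^ m + 1 + 0) + 2 * (2 * 2 ^ m)    ≡⟨ regroup (count q1 m) m (2 ^ m) ⟩
  count q1 m + 2 * 2 ^ m + (m * 2 ^ m + 1 + 2 * 2 ^ m)  ≡⟨ cong (_+ (m * 2 ^ m + 1 + 2 * 2 ^ m)) (count-q1 m) ⟩
  m * 2 ^ m + m + 3 + (m * 2 ^ m + 1 + 2 * 2 ^ m)       ≡⟨ collect m (2 ^ m) ⟩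
  suc m * (2 * 2 ^ m) + suc m + 3                       ∎
  where
  open ≡-Reasoning
  regroup : ∀ x m P → x + (m * P + 1 + 0) + 2 * (2 * P) ≡ x + 2 * P + (m * P + 1 + 2 * P)
  regroup = solve-∀
  collect : ∀ m P → m * P + m + 3 + (m * P + 1 + 2 * P) ≡ suc m * (2 * P) + suc m + 3
  collect = solve-∀

count-q0 : ∀ m → count q0 (suc m) ≡ count q1 m
count-q0 m rewrite count-dead m = +-identityʳ (count q1 m)

-- Cancelling 144·P from both sides leaves a polynomial identity in m and P.
recurrence-of-closed-forms : ∀ m P x₀ x₁ x₂ x₃ x₄ →
  x₀ + 2 * P ≡ m * P + m + 3 →
  x₁ + 2 * (2 * P) ≡ (1 + m) * (2 * P) + (1 + m) + 3 →
  x₂ + 2 * (4 * P) ≡ (2 + m) * (4 * P) + (2 + m) + 3 →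
  x₃ + 2 * (8 * P) ≡ (3 + m) * (8 * P) + (3 + m) + 3 →
  x₄ + 2 * (16 * P) ≡ (4 + m) * (16 * P) + (4 + m) + 3 →
  x₄ + 13 * x₂ + 4 * x₀ ≡ 6 * x₃ + 12 * x₁
recurrence-of-closed-forms m P x₀ x₁ x₂ x₃ x₄ e₀ e₁ e₂ e₃ e₄ = +-cancelʳ-≡ (144 * P) _ _ (begin
  x₄ + 13 * x₂ + 4 * x₀ + 144 * P
    ≡⟨ split-left x₄ x₂ x₀ P ⟩
  (x₄ + 2 * (16 * P)) + 13 * (x₂ + 2 * (4 * P)) + 4 * (x₀ + 2 * P)
    ≡⟨ cong₂ _+_ (cong₂ (λ a b → a + 13 * b) e₄ e₂) (cong (4 *_) e₀) ⟩
  ((4 + m) * (16 * P) + (4 + m) + 3) + 13 * ((2 + m) * (4 * P) + (2 + m) + 3) + 4 * (m * P + m + 3)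
    ≡⟨ closed-forms m P ⟩
  6 * ((3 + m) * (8 * P) + (3 + m) + 3) + 12 * ((1 + m) * (2 * P) + (1 + m) + 3)
    ≡⟨ cong₂ (λ a b → 6 * a + 12 * b) e₃ e₁ ⟨
  6 * (x₃ + 2 * (8 * P)) + 12 * (x₁ + 2 * (2 * P))
    ≡⟨ split-right x₃ x₁ P ⟨
  6 * x₃ + 12 * x₁ + 144 * P
    ∎)
  where
  open ≡-Reasoning
  split-left : ∀ x₄ x₂ x₀ P →
    x₄ + 13 * x₂ + 4 * x₀ + 144 * P ≡ (x₄ + 2 * (16 * P)) + 13 * (x₂ + 2 * (4 * P)) + 4 * (x₀ + 2 * P)
  split-left = solve-∀
  split-right : ∀ x₃ x₁ P → 6 * x₃ + 12 * x₁ + 144 * P ≡ 6 * (x₃ + 2 * (8 * P)) + 12 * (x₁ + 2 * (2 * P))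
  split-right = solve-∀
  closed-forms : ∀ m P → (4 + m) * (16 * P) + (4 + m) + 3 + 13 * ((2 + m) * (4 * P) + (2 + m) + 3) + 4 * (m * P + m + 3)
                       ≡ 6 * ((3 + m) * (8 * P) + (3 + m) + 3) + 12 * ((1 + m) * (2 * P) + (1 + m) + 3)
  closed-forms = solve-∀

count-q1-shifted : ∀ k m → count q1 (k + m) + 2 * (2 ^ k * 2 ^ m) ≡ (k + m) * (2 ^ k * 2 ^ m) + (k + m) + 3
count-q1-shifted k m rewrite sym (^-distribˡ-+-* 2 k m) = count-q1 (k + m)

count-q1-recurrence : ∀ m → count q1 (4 + m) + 13 * count q1 (2 + m) + 4 * count q1 m
                          ≡ 6 * count q1 (3 + m) + 12 * count q1 (1 + m)
count-q1-recurrence m =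
  recurrence-of-closed-forms m (2 ^ m) (count q1 m) (count q1 (1 + m)) (count q1 (2 + m)) (count q1 (3 + m)) (count q1 (4 + m))
    (count-q1 m)
    (count-q1-shifted 1 m) (count-q1-shifted 2 m) (count-q1-shifted 3 m) (count-q1-shifted 4 m)

-- The generating function

module Coefficients where
  open import Data.Integer as ℤ using (+_; -[1+_])
  import Data.Integer.Properties as ℤ
  open import Data.Integer.Tactic.RingSolver renaming (solve-∀ to ℤ-solve-∀)

  -- The coefficient of z^(m + 5) in (1 − 3z + 2z²)²·Σ aₙ zⁿ, where xₖ = a (m + 1 + k).
  coefficient-vanishes : ∀ x₀ x₁ x₂ x₃ x₄ → x₄ + 13 * x₂ + 4 * x₀ ≡ 6 * x₃ + 12 * x₁ →
    + 1 ℤ.* + x₄ ℤ.+ (-[1+ 5 ] ℤ.* + x₃ ℤ.+ (+ 13 ℤ.* + x₂ ℤ.+ (-[1+ 11 ] ℤ.* + x₁ ℤ.+ (+ 4 ℤ.* + x₀ ℤ.+ + 0)))) ≡ + 0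
  coefficient-vanishes x₀ x₁ x₂ x₃ x₄ e = begin
    + 1 ℤ.* + x₄ ℤ.+ (-[1+ 5 ] ℤ.* + x₃ ℤ.+ (+ 13 ℤ.* + x₂ ℤ.+ (-[1+ 11 ] ℤ.* + x₁ ℤ.+ (+ 4 ℤ.* + x₀ ℤ.+ + 0))))
      ≡⟨ rearrange (+ x₀) (+ x₁) (+ x₂) (+ x₃) (+ x₄) ⟩
    (+ x₄ ℤ.+ + 13 ℤ.* + x₂ ℤ.+ + 4 ℤ.* + x₀) ℤ.- (+ 6 ℤ.* + x₃ ℤ.+ + 12 ℤ.* + x₁)
      ≡⟨ cong₂ ℤ._-_ (sym (ℕ-to-ℤ₃ x₄ x₂ x₀)) (sym (ℕ-to-ℤ₂ x₃ x₁)) ⟩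
    + (x₄ + 13 * x₂ + 4 * x₀) ℤ.- + (6 * x₃ + 12 * x₁)
      ≡⟨ cong (λ t → + t ℤ.- + (6 * x₃ + 12 * x₁)) e ⟩
    + (6 * x₃ + 12 * x₁) ℤ.- + (6 * x₃ + 12 * x₁)
      ≡⟨ ℤ.+-inverseʳ (+ (6 * x₃ + 12 * x₁)) ⟩
    + 0 ∎
    where
    open ≡-Reasoning
    rearrange : ∀ a b c d e → + 1 ℤ.* e ℤ.+ (ℤ.- (+ 6) ℤ.* d ℤ.+ (+ 13 ℤ.* c ℤ.+ (ℤ.- (+ 12) ℤ.* b ℤ.+ (+ 4 ℤ.* a ℤ.+ + 0))))
                            ≡ (e ℤ.+ + 13 ℤ.* c ℤ.+ + 4 ℤ.* a) ℤ.- (+ 6 ℤ.* d ℤ.+ + 12 ℤ.* b)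
    rearrange = ℤ-solve-∀
    ℕ-to-ℤ₃ : ∀ x y z → + (x + 13 * y + 4 * z) ≡ + x ℤ.+ + 13 ℤ.* + y ℤ.+ + 4 ℤ.* + z
    ℕ-to-ℤ₃ x y z = trans (ℤ.pos-+ (x + 13 * y) (4 * z))
      (cong₂ ℤ._+_ (trans (ℤ.pos-+ x (13 * y)) (cong (λ t → + x ℤ.+ t) (ℤ.pos-* 13 y))) (ℤ.pos-* 4 z))
    ℕ-to-ℤ₂ : ∀ x y → + (6 * x + 12 * y) ≡ + 6 ℤ.* + x ℤ.+ + 12 ℤ.* + y
    ℕ-to-ℤ₂ x y = trans (ℤ.pos-+ (6 * x) (12 * y)) (cong₂ ℤ._+_ (ℤ.pos-* 6 x) (ℤ.pos-* 12 y))

  series-identity : (a : ℕ → ℕ) → (∀ k → a (suc k) ≡ count q1 k) →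
                    ∀ n → mulSeries (polyMul den₀ den₀) (seriesFrom1 a) n ≡ coeff numer n
  series-identity a a≡ zero                             = refl
  series-identity a a≡ (suc zero)                       rewrite a≡ 0 = refl
  series-identity a a≡ (suc (suc zero))                 rewrite a≡ 0 | a≡ 1 = refl
  series-identity a a≡ (suc (suc (suc zero)))           rewrite a≡ 0 | a≡ 1 | a≡ 2 = refl
  series-identity a a≡ (suc (suc (suc (suc zero))))     rewrite a≡ 0 | a≡ 1 | a≡ 2 | a≡ 3 = refl
  series-identity a a≡ (suc (suc (suc (suc (suc m))))) rewrite a≡ m | a≡ (1 + m) | a≡ (2 + m) | a≡ (3 + m) | a≡ (4 + m) =
    coefficient-vanishes (count q1 m) (count q1 (1 + m)) (count q1 (2 + m)) (count q1 (3 + m)) (count q1 (4 + m))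
      (count-q1-recurrence m)

open Coefficients using (series-identity)

theorem4p4 : (a : ℕ → ℕ)
    → (∀ n → Fin (a (suc n)) ↔ Avoiding (suc n) τ-1/24/3)
    → ∀ n → mulSeries (polyMul den₀ den₀) (seriesFrom1 a) n ≡ coeff numer n
theorem4p4 a a↔avoiding = series-identity a λ k → begin
  a (suc k)         ≡⟨ ↔⇒≡ (↔-trans (a↔avoiding k) (↔-trans (avoiding↔accepted (suc k)) (↔-sym (count-correct q0 (suc k))))) ⟩
  count q0 (suc k)  ≡⟨ count-q0 k ⟩
  count q1 k        ∎
  where open ≡-Reasoning
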